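{- For any integer $N>1$, there exists a non-disjoint $(2^N,N,2^{N-1},(N-1)2^{N-2})$-SEDF in $\mathbb{Z}_{2^N}$; that is, there exist non-disjoint SEDFs with $N$ sets for every $N>1$.
   Context: Groups are written additively. For subsets $A,B$ of a group $G$, $\Delta(A,B)$ denotes the multiset $\{a-b: a\in A, b\in B\}$. For a group $G$ of order $v$ and $m>1$, a family of $k$-subsets $\{A_1,\ldots,A_m\}$ of $G$ (not required to be disjoint) is a non-disjoint $(v,m,k,\lambda)$-SEDF if for each $1\le i\le m$ the multiset union $\bigcup_{j\neq i}\Delta(A_i,A_j)$ contains every element of $G$ (including $0$) exactly $\lambda$ times. -}

module Defs where

open import Data.Nat using (ℕ; suc; _+_; _∸_; NonZero)
open import Data.Nat.DivMod using (_mod_)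
open import Data.Fin using (Fin; toℕ; _≟_)
open import Data.Fin.Subset using (Subset; _∈_; ∣_∣)
open import Data.Fin.Subset.Properties using (_∈?_)
open import Data.List using (List; length; filter; allFin; cartesianProduct; map)
open import Data.Nat.ListAction using (sum)
open import Data.Product using (_×_; _,_; proj₁; proj₂)
open import Relation.Nullary using (Dec; yes; no; ¬_; _×-dec_)
open import Relation.Nullary.Decidable using (¬?)
open import Relation.Binary.PropositionalEquality using (_≡_)

_⊖_ : {v : ℕ} .{{_ : NonZero v}} → Fin v → Fin v → Fin v
_⊖_ {v} a b = (toℕ a + (v ∸ toℕ b)) mod v

-- Multiplicity of g in the multiset Δ(A,B) = {a - b : a ∈ A, b ∈ B}
-- (the number of pairs (a,b) ∈ A × B with a - b = g).
Δmult : {v : ℕ} .{{_ : NonZero v}} → Subset v → Subset v → Fin v → ℕ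
Δmult {v} A B g =
  length (filter (λ p → (proj₁ p ∈? A) ×-dec ((proj₂ p ∈? B) ×-dec ((proj₁ p ⊖ proj₂ p) ≟ g)))
                 (cartesianProduct (allFin v) (allFin v)))

unionMult : {v m : ℕ} .{{_ : NonZero v}} → (Fin m → Subset v) → Fin m → Fin v → ℕ
unionMult {v} {m} A i g =
  sum (map (λ j → Δmult (A i) (A j) g) (filter (λ j → ¬? (j ≟ i)) (allFin m)))

-- A non-disjoint (v,m,k,λ)-SEDF in ℤ_v: m > 1 k-subsets A_1,…,A_m of ℤ_v
-- (not required to be disjoint or distinct) such that for every i, every
-- g ∈ ℤ_v (including 0) occurs exactly λ times in ⋃_{j≠i} Δ(A_i,A_j).
record IsNonDisjointSEDF (v m k λ' : ℕ) .{{_ : NonZero v}} (A : Fin m → Subset v) : Set where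
  field
    m>1   : 1 Data.Nat.< m
    size  : ∀ i → ∣ A i ∣ ≡ k
    count : ∀ i (g : Fin v) → unionMult A i g ≡ λ'

-- Take A_i ⊆ ℤ_{2^N} to be the residues whose i-th binary digit is 0, so |A_i| = 2^{N-1}.
-- For i ≠ j, the multiplicity of g in Δ(A_i, A_j) is the number of a with bit i of a and
-- bit j of a − g both zero.  If j < i, this condition has period 2^{i+1} in a; within one
-- period bit i confines a to [0, 2^i), which consists of 2^{i-j-1} whole periods of bit j,
-- each contributing 2^j.  So the count is 2^{N-i-1} · 2^{i-j-1} · 2^j = 2^{N-2}.  If i < j,
-- substituting a ↦ a + g exchanges the roles of i and j.  Summing over the N − 1 indices
-- j ≠ i gives λ = (N − 1) 2^{N-2}.

module Submission where

open import Data.Bool using (Bool; true; false; not; _∧_)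
open import Data.Empty using (⊥-elim)
open import Data.Fin as Fin using (Fin; toℕ)
open import Data.Fin.Properties using (toℕ-injective; toℕ<n; toℕ-fromℕ<)
open import Data.Fin.Subset using (Subset; _∈_; ∣_∣)
open import Data.Fin.Subset.Properties using (_∈?_)
open import Data.List as List using (List; []; _∷_; _++_; length; filter; allFin; cartesianProduct; map)
open import Data.List.Properties using (map-++; map-∘; map-tabulate)
open import Data.Nat
open import Data.Nat.DivMod
open import Data.Nat.Divisibility using (divides)
open import Data.Nat.ListAction using (sum)
open import Data.Nat.ListAction.Properties using (sum-++)
open import Data.Nat.Properties
open import Data.Nat.Solver using (module +-*-Solver)
open import Data.Product using (∃; _×_; _,_)
open import Data.Vec using (tabulate)
open import Function using (_∘_; _⇔_; mk⇔)
open import Relation.Binary using (tri<; tri≈; tri>)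
open import Relation.Binary.PropositionalEquality
open import Relation.Nullary using (Dec; yes; no; does)
open import Relation.Nullary.Decidable using (dec-true; dec-false; does-⇔; ¬?; _×-dec_)
open import Relation.Unary using (Decidable)
open import Algebra.Properties.CommutativeSemigroup +-commutativeSemigroup using (xy∙z≈xz∙y)

open import Defs

𝕀 : Bool → ℕ
𝕀 true  = 1
𝕀 false = 0

𝕀-∧ : ∀ a b → 𝕀 (a ∧ b) ≡ 𝕀 a * 𝕀 b
𝕀-∧ true  b = sym (+-identityʳ (𝕀 b))
𝕀-∧ false b = refl

∑ : ℕ → (ℕ → ℕ) → ℕ
∑ zero    f = 0
∑ (suc n) f = f 0 + ∑ n (f ∘ suc)

syntax ∑ n (λ x → e) = ∑[ x < n ] e

∑-cong : ∀ n {f g : ℕ → ℕ} → (∀ x → x < n → f x ≡ g x) → ∑ n f ≡ ∑ n g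
∑-cong zero    eq = refl
∑-cong (suc n) eq = cong₂ _+_ (eq 0 z<s) (∑-cong n (λ x x<n → eq (suc x) (s<s x<n)))

∑-const : ∀ n k → ∑[ _ < n ] k ≡ n * k
∑-const zero    k = refl
∑-const (suc n) k = cong (k +_) (∑-const n k)

∑-*ˡ : ∀ n k (f : ℕ → ℕ) → ∑[ x < n ] (k * f x) ≡ k * ∑ n f
∑-*ˡ zero    k f = sym (*-zeroʳ k)
∑-*ˡ (suc n) k f = trans (cong (k * f 0 +_) (∑-*ˡ n k (f ∘ suc))) (sym (*-distribˡ-+ k (f 0) _))

∑-+ : ∀ m n (f : ℕ → ℕ) → ∑ (m + n) f ≡ ∑ m f + ∑[ x < n ] f (m + x)
∑-+ zero    n f = refl
∑-+ (suc m) n f = trans (cong (f 0 +_) (∑-+ m n (f ∘ suc))) (sym (+-assoc (f 0) _ _))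

∑-indicator : ∀ n t (f : ℕ → ℕ) → t < n → ∑[ x < n ] (𝕀 (x ≡ᵇ t) * f x) ≡ f t
∑-indicator (suc n) zero    f _         =
  trans (cong₂ _+_ (+-identityʳ (f 0)) (trans (∑-const n 0) (*-zeroʳ n))) (+-identityʳ (f 0))
∑-indicator (suc n) (suc t) f (s<s t<n) = ∑-indicator n t (f ∘ suc) t<n

∑-indicator-≢ : ∀ n t → t < n → ∑[ x < n ] 𝕀 (not (x ≡ᵇ t)) ≡ n ∸ 1
∑-indicator-≢ (suc n) zero    _         = trans (∑-const n 1) (*-identityʳ n)
∑-indicator-≢ (suc n) (suc t) (s<s t<n) =
  trans (cong suc (∑-indicator-≢ n t t<n)) (m+[n∸m]≡n {1} {n} (≤-trans z<s t<n))

Periodic : {A : Set} → (ℕ → A) → ℕ → Set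
Periodic f p = ∀ x → f (x + p) ≡ f x

module _ {A : Set} {f : ℕ → A} {p : ℕ} (f-periodic : Periodic f p) where

  periodic-multiple : ∀ q → Periodic f (q * p)
  periodic-multiple zero    x = cong f (+-identityʳ x)
  periodic-multiple (suc q) x =
    trans (cong f (sym (+-assoc x p (q * p)))) (trans (periodic-multiple q (x + p)) (f-periodic x))

  periodic-shift : ∀ c → Periodic (λ x → f (x + c)) p
  periodic-shift c x = trans (cong f (xy∙z≈xz∙y x p c)) (f-periodic (x + c))

periodic-* : ∀ {f g : ℕ → ℕ} {p} → Periodic f p → Periodic g p → Periodic (λ x → f x * g x) p
periodic-* f-periodic g-periodic x = cong₂ _*_ (f-periodic x) (g-periodic x)

∑-periodic-suc : ∀ p (f : ℕ → ℕ) → Periodic f p → ∑[ x < p ] f (suc x) ≡ ∑ p f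
∑-periodic-suc p f f-periodic = +-cancelˡ-≡ (f 0) _ _ (begin
  ∑ (suc p) f          ≡⟨ cong (λ n → ∑ n f) (+-comm 1 p) ⟩
  ∑ (p + 1) f          ≡⟨ ∑-+ p 1 f ⟩
  ∑ p f + (f (p + 0) + 0) ≡⟨ cong (∑ p f +_) (trans (+-identityʳ _) (trans (cong f (+-identityʳ p)) (f-periodic 0))) ⟩
  ∑ p f + f 0          ≡⟨ +-comm (∑ p f) (f 0) ⟩
  f 0 + ∑ p f          ∎)
  where open ≡-Reasoning

∑-rotate : ∀ c p (f : ℕ → ℕ) → Periodic f p → ∑[ x < p ] f (x + c) ≡ ∑ p f
∑-rotate zero    p f f-periodic = ∑-cong p (λ x _ → cong f (+-identityʳ x))
∑-rotate (suc c) p f f-periodic = begin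
  ∑[ x < p ] f (x + suc c)   ≡⟨ ∑-cong p (λ x _ → cong f (+-suc x c)) ⟩
  ∑[ x < p ] f (suc x + c)   ≡⟨ ∑-periodic-suc p (λ x → f (x + c)) (periodic-shift f-periodic c) ⟩
  ∑[ x < p ] f (x + c)       ≡⟨ ∑-rotate c p f f-periodic ⟩
  ∑ p f                      ∎
  where open ≡-Reasoning

∑-periodic : ∀ q p (f : ℕ → ℕ) → Periodic f p → ∑ (q * p) f ≡ q * ∑ p f
∑-periodic zero    p f f-periodic = refl
∑-periodic (suc q) p f f-periodic = begin
  ∑ (p + q * p) f                      ≡⟨ ∑-+ p (q * p) f ⟩
  ∑ p f + ∑[ x < q * p ] f (p + x)     ≡⟨ cong (∑ p f +_) (∑-cong (q * p) (λ x _ → trans (cong f (+-comm p x)) (f-periodic x))) ⟩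
  ∑ p f + ∑ (q * p) f                  ≡⟨ cong (∑ p f +_) (∑-periodic q p f f-periodic) ⟩
  ∑ p f + q * ∑ p f                    ∎
  where open ≡-Reasoning

length-filter≡sum : ∀ {A : Set} {P : A → Set} (P? : Decidable P) (xs : List A) →
  length (filter P? xs) ≡ sum (map (𝕀 ∘ does ∘ P?) xs)
length-filter≡sum P? []       = refl
length-filter≡sum P? (x ∷ xs) with does (P? x)
... | true  = cong suc (length-filter≡sum P? xs)
... | false = length-filter≡sum P? xs

sum-map-filter : ∀ {A : Set} {P : A → Set} (P? : Decidable P) (f : A → ℕ) (xs : List A) →
  sum (map f (filter P? xs)) ≡ sum (map (λ x → 𝕀 (does (P? x)) * f x) xs)
sum-map-filter P? f []       = refl
sum-map-filter P? f (x ∷ xs) with does (P? x)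
... | true  = cong₂ _+_ (sym (+-identityʳ (f x))) (sum-map-filter P? f xs)
... | false = sum-map-filter P? f xs

sum-map-cartesianProduct : ∀ {A B : Set} (h : A × B → ℕ) (xs : List A) (ys : List B) →
  sum (map h (cartesianProduct xs ys)) ≡ sum (map (λ a → sum (map (λ b → h (a , b)) ys)) xs)
sum-map-cartesianProduct h []       ys = refl
sum-map-cartesianProduct h (x ∷ xs) ys = begin
  sum (map h (map (x ,_) ys ++ cartesianProduct xs ys))           ≡⟨ cong sum (map-++ h (map (x ,_) ys) _) ⟩
  sum (map h (map (x ,_) ys) ++ map h (cartesianProduct xs ys))   ≡⟨ sum-++ (map h (map (x ,_) ys)) _ ⟩
  sum (map h (map (x ,_) ys)) + sum (map h (cartesianProduct xs ys))
    ≡⟨ cong₂ _+_ (cong sum (sym (map-∘ ys))) (sum-map-cartesianProduct h xs ys) ⟩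
  sum (map (λ b → h (x , b)) ys) + sum (map (λ a → sum (map (λ b → h (a , b)) ys)) xs) ∎
  where open ≡-Reasoning

sum-map-allFin : ∀ n (f : Fin n → ℕ) (g : ℕ → ℕ) → (∀ x → f x ≡ g (toℕ x)) → sum (map f (allFin n)) ≡ ∑ n g
sum-map-allFin n f g f≗g = trans (cong sum (map-tabulate (λ x → x) f)) (sum-tabulate n f g f≗g)
  where
  sum-tabulate : ∀ n (f : Fin n → ℕ) (g : ℕ → ℕ) → (∀ x → f x ≡ g (toℕ x)) → sum (List.tabulate f) ≡ ∑ n g
  sum-tabulate zero    f g f≗g = refl
  sum-tabulate (suc n) f g f≗g = cong₂ _+_ (f≗g Fin.zero) (sum-tabulate n (f ∘ Fin.suc) (g ∘ suc) (f≗g ∘ Fin.suc))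

does-≟-toℕ : ∀ {n} (i j : Fin n) → does (i Fin.≟ j) ≡ (toℕ i ≡ᵇ toℕ j)
does-≟-toℕ i j = does-⇔ (mk⇔ (cong toℕ) toℕ-injective) (i Fin.≟ j) (toℕ i ≟ toℕ j)

sum-filter-≢ : ∀ {N} (i : Fin N) (f : Fin N → ℕ) K → (∀ j → j ≢ i → f j ≡ K) →
  sum (map f (filter (λ j → ¬? (j Fin.≟ i)) (allFin N))) ≡ (N ∸ 1) * K
sum-filter-≢ {N} i f K f≡K = begin
  sum (map f (filter (λ j → ¬? (j Fin.≟ i)) (allFin N)))
    ≡⟨ sum-map-filter (λ j → ¬? (j Fin.≟ i)) f (allFin N) ⟩
  sum (map (λ j → 𝕀 (not (does (j Fin.≟ i))) * f j) (allFin N))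
    ≡⟨ sum-map-allFin N _ _ (λ j → trans (entry j (j Fin.≟ i)) (cong (λ b → K * 𝕀 (not b)) (does-≟-toℕ j i))) ⟩
  ∑[ x < N ] (K * 𝕀 (not (x ≡ᵇ toℕ i)))
    ≡⟨ ∑-*ˡ N K _ ⟩
  K * ∑[ x < N ] 𝕀 (not (x ≡ᵇ toℕ i))
    ≡⟨ cong (K *_) (∑-indicator-≢ N (toℕ i) (toℕ<n i)) ⟩
  K * (N ∸ 1)
    ≡⟨ *-comm K (N ∸ 1) ⟩
  (N ∸ 1) * K
    ∎
  where
  open ≡-Reasoning
  entry : ∀ j (j≟i : Dec (j ≡ i)) → 𝕀 (not (does j≟i)) * f j ≡ K * 𝕀 (not (does j≟i))
  entry j (yes _)   = sym (*-zeroʳ K)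
  entry j (no j≢i) = trans (+-identityʳ (f j)) (trans (f≡K j j≢i) (sym (*-identityʳ K)))

∈?-tabulate : ∀ {n} (f : Fin n → Bool) x → does (x ∈? tabulate f) ≡ f x
∈?-tabulate f Fin.zero with f Fin.zero
... | true  = refl
... | false = refl
∈?-tabulate f (Fin.suc x) = ∈?-tabulate (f ∘ Fin.suc) x

∣tabulate∣ : ∀ n (f : ℕ → Bool) → ∣ tabulate {n = n} (f ∘ toℕ) ∣ ≡ ∑[ x < n ] 𝕀 (f x)
∣tabulate∣ zero    f = refl
∣tabulate∣ (suc n) f with f 0
... | true  = cong suc (∣tabulate∣ n (f ∘ suc))
... | false = ∣tabulate∣ n (f ∘ suc)

%-cong-+ʳ : ∀ {m n} o {d} .{{_ : NonZero d}} → m % d ≡ n % d → (m + o) % d ≡ (n + o) % d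
%-cong-+ʳ {m} {n} o {d} eq = begin
  (m + o) % d              ≡⟨ %-distribˡ-+ m o d ⟩
  (m % d + o % d) % d      ≡⟨ cong (λ r → (r + o % d) % d) eq ⟩
  (n % d + o % d) % d      ≡⟨ %-distribˡ-+ n o d ⟨
  (n + o) % d              ∎
  where open ≡-Reasoning

%-∸-swap : ∀ v .{{_ : NonZero v}} a b g → b < v → g ≤ v → (a + (v ∸ b)) % v ≡ g → (a + (v ∸ g)) % v ≡ b
%-∸-swap v a b g b<v g≤v a-b≡g = begin
  (a + (v ∸ g)) % v                    ≡⟨ [m+n]%n≡m%n (a + (v ∸ g)) v ⟨
  (a + (v ∸ g) + v) % v                ≡⟨ cong (λ w → (a + (v ∸ g) + w) % v) (m∸n+n≡m (<⇒≤ b<v)) ⟨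
  (a + (v ∸ g) + ((v ∸ b) + b)) % v    ≡⟨ cong (_% v) (rearrange a (v ∸ g) (v ∸ b) b) ⟩
  (a + (v ∸ b) + (v ∸ g) + b) % v      ≡⟨ %-cong-+ʳ b (%-cong-+ʳ (v ∸ g) (m%n%n≡m%n (a + (v ∸ b)) v)) ⟨
  (a-b + (v ∸ g) + b) % v              ≡⟨ cong (λ r → (r + (v ∸ g) + b) % v) a-b≡g ⟩
  (g + (v ∸ g) + b) % v                ≡⟨ cong (λ r → (r + b) % v) (m+[n∸m]≡n g≤v) ⟩
  (v + b) % v                          ≡⟨ cong (_% v) (+-comm v b) ⟩
  (b + v) % v                          ≡⟨ [m+n]%n≡m%n b v ⟩
  b % v                                ≡⟨ m<n⇒m%n≡m b<v ⟩
  b                                    ∎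
  where
  open ≡-Reasoning
  open +-*-Solver
  a-b : ℕ
  a-b = (a + (v ∸ b)) % v
  rearrange : ∀ a x y b → a + x + (y + b) ≡ a + y + x + b
  rearrange = solve 4 (λ a x y b → a :+ x :+ (y :+ b) := a :+ y :+ x :+ b) refl

toℕ-⊖ : ∀ {v} .{{_ : NonZero v}} (a b : Fin v) → toℕ (a ⊖ b) ≡ (toℕ a + (v ∸ toℕ b)) % v
toℕ-⊖ {v} a b = toℕ-fromℕ< (m%n<n (toℕ a + (v ∸ toℕ b)) v)

⊖≡⇔ : ∀ {v} .{{_ : NonZero v}} (a b g : Fin v) → a ⊖ b ≡ g ⇔ toℕ b ≡ (toℕ a + (v ∸ toℕ g)) % v
⊖≡⇔ {v} a b g = mk⇔
  (λ a⊖b≡g → sym (%-∸-swap v (toℕ a) (toℕ b) (toℕ g) (toℕ<n b) (<⇒≤ (toℕ<n g))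
                   (trans (sym (toℕ-⊖ a b)) (cong toℕ a⊖b≡g))))
  (λ b≡a-g → toℕ-injective (trans (toℕ-⊖ a b)
                   (%-∸-swap v (toℕ a) (toℕ g) (toℕ b) (toℕ<n g) (<⇒≤ (toℕ<n b)) (sym b≡a-g))))

Δmult-tabulate : ∀ {v} .{{_ : NonZero v}} (f h : ℕ → Bool) (g : Fin v) →
  Δmult (tabulate (f ∘ toℕ)) (tabulate (h ∘ toℕ)) g ≡ ∑[ a < v ] (𝕀 (f a) * 𝕀 (h ((a + (v ∸ toℕ g)) % v)))
Δmult-tabulate {v} f h g = begin
  length (filter D (cartesianProduct (allFin v) (allFin v)))
    ≡⟨ length-filter≡sum D (cartesianProduct (allFin v) (allFin v)) ⟩
  sum (map (𝕀 ∘ does ∘ D) (cartesianProduct (allFin v) (allFin v)))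
    ≡⟨ sum-map-cartesianProduct (𝕀 ∘ does ∘ D) (allFin v) (allFin v) ⟩
  sum (map (λ a → sum (map (λ b → 𝕀 (does (D (a , b)))) (allFin v))) (allFin v))
    ≡⟨ sum-map-allFin v _ _ row ⟩
  ∑[ a < v ] (𝕀 (f a) * 𝕀 (h (a-g a)))
    ∎
  where
  open ≡-Reasoning
  A B : Subset v
  A = tabulate (f ∘ toℕ)
  B = tabulate (h ∘ toℕ)
  D : Decidable (λ ((a , b) : Fin v × Fin v) → a ∈ A × b ∈ B × a ⊖ b ≡ g)
  D (a , b) = (a ∈? A) ×-dec ((b ∈? B) ×-dec ((a ⊖ b) Fin.≟ g))
  a-g : ℕ → ℕ
  a-g a = (a + (v ∸ toℕ g)) % v
  entry : ∀ a b → 𝕀 (does (D (a , b))) ≡ 𝕀 (f (toℕ a)) * (𝕀 (toℕ b ≡ᵇ a-g (toℕ a)) * 𝕀 (h (toℕ b)))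
  entry a b = begin
    𝕀 (does (a ∈? A) ∧ (does (b ∈? B) ∧ does (a ⊖ b Fin.≟ g)))
      ≡⟨ cong₂ (λ x y → 𝕀 (x ∧ y)) (∈?-tabulate (f ∘ toℕ) a)
           (cong₂ _∧_ (∈?-tabulate (h ∘ toℕ) b) (does-⇔ (⊖≡⇔ a b g) (a ⊖ b Fin.≟ g) (toℕ b ≟ a-g (toℕ a)))) ⟩
    𝕀 (f (toℕ a) ∧ (h (toℕ b) ∧ (toℕ b ≡ᵇ a-g (toℕ a))))
      ≡⟨ trans (𝕀-∧ (f (toℕ a)) _) (cong (𝕀 (f (toℕ a)) *_) (𝕀-∧ (h (toℕ b)) _)) ⟩
    𝕀 (f (toℕ a)) * (𝕀 (h (toℕ b)) * 𝕀 (toℕ b ≡ᵇ a-g (toℕ a)))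
      ≡⟨ cong (𝕀 (f (toℕ a)) *_) (*-comm (𝕀 (h (toℕ b))) _) ⟩
    𝕀 (f (toℕ a)) * (𝕀 (toℕ b ≡ᵇ a-g (toℕ a)) * 𝕀 (h (toℕ b)))
      ∎
  row : ∀ a → sum (map (λ b → 𝕀 (does (D (a , b)))) (allFin v)) ≡ 𝕀 (f (toℕ a)) * 𝕀 (h (a-g (toℕ a)))
  row a = begin
    sum (map (λ b → 𝕀 (does (D (a , b)))) (allFin v))
      ≡⟨ sum-map-allFin v _ _ (entry a) ⟩
    ∑[ b < v ] (𝕀 (f (toℕ a)) * (𝕀 (b ≡ᵇ a-g (toℕ a)) * 𝕀 (h b)))
      ≡⟨ ∑-*ˡ v (𝕀 (f (toℕ a))) _ ⟩
    𝕀 (f (toℕ a)) * ∑[ b < v ] (𝕀 (b ≡ᵇ a-g (toℕ a)) * 𝕀 (h b))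
      ≡⟨ cong (𝕀 (f (toℕ a)) *_) (∑-indicator v (a-g (toℕ a)) (𝕀 ∘ h) (m%n<n _ v)) ⟩
    𝕀 (f (toℕ a)) * 𝕀 (h (a-g (toℕ a)))
      ∎

-- Passed explicitly: instance search cannot solve NonZero (2 ^ k) since it cannot invert 2 ^_.
2^-nonZero : ∀ k → NonZero (2 ^ k)
2^-nonZero k = m^n≢0 2 k

2^-+ : ∀ m n → 2 ^ (m + n) ≡ 2 ^ n * 2 ^ m
2^-+ m n = trans (^-distribˡ-+-* 2 m n) (*-comm (2 ^ m) (2 ^ n))

bitIsZero : ℕ → ℕ → Bool
bitIsZero k x = does (_%_ x (2 ^ suc k) {{2^-nonZero (suc k)}} <? 2 ^ k)

bitIsZero-periodic : ∀ k → Periodic (bitIsZero k) (2 ^ suc k)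
bitIsZero-periodic k x =
  cong (λ r → does (r <? 2 ^ k)) ([m+n]%n≡m%n x (2 ^ suc k) {{2^-nonZero (suc k)}})

bitIsZero-periodic-2^ : ∀ k N → k < N → Periodic (bitIsZero k) (2 ^ N)
bitIsZero-periodic-2^ k N k<N with m≤n⇒∃[o]m+o≡n k<N
... | r , refl =
  subst (Periodic (bitIsZero k)) (sym (2^-+ (suc k) r)) (periodic-multiple (bitIsZero-periodic k) (2 ^ r))

bitIsZero-%-2^ : ∀ j N x → j < N → bitIsZero j (_%_ x (2 ^ N) {{2^-nonZero N}}) ≡ bitIsZero j x
bitIsZero-%-2^ j N x j<N with m≤n⇒∃[o]m+o≡n j<N
... | r , refl = cong (λ y → does (y <? 2 ^ j))
  (m∣n⇒o%n%m≡o%m (2 ^ suc j) (2 ^ (suc j + r)) x {{2^-nonZero (suc j)}} {{2^-nonZero (suc j + r)}}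
    (divides (2 ^ r) (2^-+ (suc j) r)))

bitIsZero-low : ∀ k x → x < 2 ^ k → bitIsZero k x ≡ true
bitIsZero-low k x x<2^k
  rewrite m<n⇒m%n≡m {m = x} {{2^-nonZero (suc k)}} (<-≤-trans x<2^k (m≤m+n (2 ^ k) _)) =
  dec-true (x <? 2 ^ k) x<2^k

bitIsZero-high : ∀ k x → x < 2 ^ k → bitIsZero k (2 ^ k + x) ≡ false
bitIsZero-high k x x<2^k
  rewrite m<n⇒m%n≡m {m = 2 ^ k + x} {{2^-nonZero (suc k)}}
            (+-monoʳ-< (2 ^ k) (<-≤-trans x<2^k (m≤m+n (2 ^ k) 0))) =
  dec-false (2 ^ k + x <? 2 ^ k) (λ lt → <-irrefl refl (<-≤-trans lt (m≤m+n (2 ^ k) x)))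

∑-bitIsZero-period : ∀ k (F : ℕ → ℕ) → ∑[ x < 2 ^ suc k ] (𝕀 (bitIsZero k x) * F x) ≡ ∑ (2 ^ k) F
∑-bitIsZero-period k F = begin
  ∑ (2 ^ suc k) G                                  ≡⟨ cong (λ n → ∑ (2 ^ k + n) G) (+-identityʳ (2 ^ k)) ⟩
  ∑ (2 ^ k + 2 ^ k) G                              ≡⟨ ∑-+ (2 ^ k) (2 ^ k) G ⟩
  ∑ (2 ^ k) G + ∑[ x < 2 ^ k ] G (2 ^ k + x)       ≡⟨ cong₂ _+_ (∑-cong (2 ^ k) lowHalf) (∑-cong (2 ^ k) highHalf) ⟩
  ∑ (2 ^ k) F + ∑[ _ < 2 ^ k ] 0                   ≡⟨ cong (∑ (2 ^ k) F +_) (trans (∑-const (2 ^ k) 0) (*-zeroʳ (2 ^ k))) ⟩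
  ∑ (2 ^ k) F + 0                                  ≡⟨ +-identityʳ _ ⟩
  ∑ (2 ^ k) F                                      ∎
  where
  open ≡-Reasoning
  G : ℕ → ℕ
  G x = 𝕀 (bitIsZero k x) * F x
  lowHalf : ∀ x → x < 2 ^ k → G x ≡ F x
  lowHalf x x<2^k = trans (cong (λ b → 𝕀 b * F x) (bitIsZero-low k x x<2^k)) (+-identityʳ (F x))
  highHalf : ∀ x → x < 2 ^ k → G (2 ^ k + x) ≡ 0
  highHalf x x<2^k = cong (λ b → 𝕀 b * F (2 ^ k + x)) (bitIsZero-high k x x<2^k)

∑-bitIsZero-shifted : ∀ k q c → ∑[ x < q * 2 ^ suc k ] 𝕀 (bitIsZero k (x + c)) ≡ q * 2 ^ k
∑-bitIsZero-shifted k q c = begin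
  ∑[ x < q * 2 ^ suc k ] 𝕀 (bitIsZero k (x + c))     ≡⟨ ∑-periodic q (2 ^ suc k) _ (periodic-shift 𝕀-periodic c) ⟩
  q * ∑[ x < 2 ^ suc k ] 𝕀 (bitIsZero k (x + c))     ≡⟨ cong (q *_) (∑-rotate c (2 ^ suc k) _ 𝕀-periodic) ⟩
  q * ∑[ x < 2 ^ suc k ] 𝕀 (bitIsZero k x)           ≡⟨ cong (q *_) (∑-cong (2 ^ suc k) (λ x _ → sym (*-identityʳ _))) ⟩
  q * ∑[ x < 2 ^ suc k ] (𝕀 (bitIsZero k x) * 1)     ≡⟨ cong (q *_) (∑-bitIsZero-period k (λ _ → 1)) ⟩
  q * ∑[ _ < 2 ^ k ] 1                               ≡⟨ cong (q *_) (trans (∑-const (2 ^ k) 1) (*-identityʳ _)) ⟩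
  q * 2 ^ k                                          ∎
  where
  open ≡-Reasoning
  𝕀-periodic : Periodic (𝕀 ∘ bitIsZero k) (2 ^ suc k)
  𝕀-periodic = cong 𝕀 ∘ bitIsZero-periodic k

∑-bitIsZero : ∀ k N → k < N → ∑[ x < 2 ^ N ] 𝕀 (bitIsZero k x) ≡ 2 ^ (N ∸ 1)
∑-bitIsZero k N k<N with m≤n⇒∃[o]m+o≡n k<N
... | r , refl = begin
  ∑[ x < 2 ^ N ] 𝕀 (bitIsZero k x)                ≡⟨ cong (λ n → ∑ n (𝕀 ∘ bitIsZero k)) (2^-+ (suc k) r) ⟩
  ∑[ x < 2 ^ r * 2 ^ suc k ] 𝕀 (bitIsZero k x)     ≡⟨ ∑-cong (2 ^ r * 2 ^ suc k) (λ x _ → cong (𝕀 ∘ bitIsZero k) (+-identityʳ x)) ⟨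
  ∑[ x < 2 ^ r * 2 ^ suc k ] 𝕀 (bitIsZero k (x + 0)) ≡⟨ ∑-bitIsZero-shifted k (2 ^ r) 0 ⟩
  2 ^ r * 2 ^ k                                   ≡⟨ 2^-+ k r ⟨
  2 ^ (k + r)                                     ∎
  where open ≡-Reasoning

∑-bitIsZero-pair-> : ∀ N i j c → j < i → i < N →
  ∑[ a < 2 ^ N ] (𝕀 (bitIsZero i a) * 𝕀 (bitIsZero j (a + c))) ≡ 2 ^ (N ∸ 2)
∑-bitIsZero-pair-> N i j c j<i i<N with m≤n⇒∃[o]m+o≡n j<i | m≤n⇒∃[o]m+o≡n i<N
... | s , refl | r , refl = begin
  ∑ (2 ^ N) F                       ≡⟨ cong (λ n → ∑ n F) (2^-+ (suc i) r) ⟩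
  ∑ (2 ^ r * 2 ^ suc i) F           ≡⟨ ∑-periodic (2 ^ r) (2 ^ suc i) F F-periodic ⟩
  2 ^ r * ∑ (2 ^ suc i) F           ≡⟨ cong (2 ^ r *_) (∑-bitIsZero-period i G) ⟩
  2 ^ r * ∑ (2 ^ i) G               ≡⟨ cong (λ n → 2 ^ r * ∑ n G) (2^-+ (suc j) s) ⟩
  2 ^ r * ∑ (2 ^ s * 2 ^ suc j) G   ≡⟨ cong (2 ^ r *_) (∑-bitIsZero-shifted j (2 ^ s) c) ⟩
  2 ^ r * (2 ^ s * 2 ^ j)           ≡⟨ sym (trans (2^-+ (j + s) r) (cong (2 ^ r *_) (2^-+ j s))) ⟩
  2 ^ (j + s + r)                   ∎
  where
  open ≡-Reasoning
  G : ℕ → ℕ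
  G a = 𝕀 (bitIsZero j (a + c))
  F : ℕ → ℕ
  F a = 𝕀 (bitIsZero i a) * G a
  F-periodic : Periodic F (2 ^ suc i)
  F-periodic = periodic-* (cong 𝕀 ∘ bitIsZero-periodic i)
    (cong 𝕀 ∘ periodic-shift (bitIsZero-periodic-2^ j (suc i) (m<n⇒m<1+n j<i)) c)

∑-bitIsZero-pair-< : ∀ N i j c → i < j → j < N → c ≤ 2 ^ N →
  ∑[ a < 2 ^ N ] (𝕀 (bitIsZero i a) * 𝕀 (bitIsZero j (a + c))) ≡ 2 ^ (N ∸ 2)
∑-bitIsZero-pair-< N i j c i<j j<N c≤2^N = begin
  ∑ (2 ^ N) F                                               ≡⟨ sym (∑-rotate d (2 ^ N) F F-periodic) ⟩
  ∑[ x < 2 ^ N ] F (x + d)                                  ≡⟨ ∑-cong (2 ^ N) (λ x _ → swapped x) ⟩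
  ∑[ x < 2 ^ N ] (𝕀 (bitIsZero j x) * 𝕀 (bitIsZero i (x + d))) ≡⟨ ∑-bitIsZero-pair-> N j i d i<j j<N ⟩
  2 ^ (N ∸ 2)                                               ∎
  where
  open ≡-Reasoning
  d : ℕ
  d = 2 ^ N ∸ c
  F : ℕ → ℕ
  F a = 𝕀 (bitIsZero i a) * 𝕀 (bitIsZero j (a + c))
  F-periodic : Periodic F (2 ^ N)
  F-periodic = periodic-* (cong 𝕀 ∘ bitIsZero-periodic-2^ i N (<-trans i<j j<N))
    (cong 𝕀 ∘ periodic-shift (bitIsZero-periodic-2^ j N j<N) c)
  swapped : ∀ x → F (x + d) ≡ 𝕀 (bitIsZero j x) * 𝕀 (bitIsZero i (x + d))
  swapped x = trans (*-comm (𝕀 (bitIsZero i (x + d))) _)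
    (cong (λ b → 𝕀 b * 𝕀 (bitIsZero i (x + d))) (begin
      bitIsZero j (x + d + c)     ≡⟨ cong (bitIsZero j) (+-assoc x d c) ⟩
      bitIsZero j (x + (d + c))   ≡⟨ cong (λ y → bitIsZero j (x + y)) (m∸n+n≡m c≤2^N) ⟩
      bitIsZero j (x + 2 ^ N)     ≡⟨ bitIsZero-periodic-2^ j N j<N x ⟩
      bitIsZero j x               ∎))

∑-bitIsZero-pair : ∀ N i j c → i ≢ j → i < N → j < N → c ≤ 2 ^ N →
  ∑[ a < 2 ^ N ] (𝕀 (bitIsZero i a) * 𝕀 (bitIsZero j (a + c))) ≡ 2 ^ (N ∸ 2)
∑-bitIsZero-pair N i j c i≢j i<N j<N c≤2^N with <-cmp i j
... | tri< i<j _ _ = ∑-bitIsZero-pair-< N i j c i<j j<N c≤2^N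
... | tri≈ _ i≡j _ = ⊥-elim (i≢j i≡j)
... | tri> _ _ j<i = ∑-bitIsZero-pair-> N i j c j<i i<N

zeroBitSet : (N : ℕ) → Fin N → Subset (2 ^ N)
zeroBitSet N i = tabulate (bitIsZero (toℕ i) ∘ toℕ)

∣zeroBitSet∣ : ∀ N (i : Fin N) → ∣ zeroBitSet N i ∣ ≡ 2 ^ (N ∸ 1)
∣zeroBitSet∣ N i = trans (∣tabulate∣ (2 ^ N) (bitIsZero (toℕ i))) (∑-bitIsZero (toℕ i) N (toℕ<n i))

Δmult-zeroBitSet : ∀ N (i j : Fin N) g → i ≢ j →
  Δmult {{2^-nonZero N}} (zeroBitSet N i) (zeroBitSet N j) g ≡ 2 ^ (N ∸ 2)
Δmult-zeroBitSet N i j g i≢j = begin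
  Δmult {{2^-nonZero N}} (zeroBitSet N i) (zeroBitSet N j) g
    ≡⟨ Δmult-tabulate {{2^-nonZero N}} (bitIsZero (toℕ i)) (bitIsZero (toℕ j)) g ⟩
  ∑[ a < 2 ^ N ] (𝕀 (bitIsZero (toℕ i) a) * 𝕀 (bitIsZero (toℕ j) (_%_ (a + c) (2 ^ N) {{2^-nonZero N}})))
    ≡⟨ ∑-cong (2 ^ N) (λ a _ → cong (λ b → 𝕀 (bitIsZero (toℕ i) a) * 𝕀 b) (bitIsZero-%-2^ (toℕ j) N (a + c) (toℕ<n j))) ⟩
  ∑[ a < 2 ^ N ] (𝕀 (bitIsZero (toℕ i) a) * 𝕀 (bitIsZero (toℕ j) (a + c)))
    ≡⟨ ∑-bitIsZero-pair N (toℕ i) (toℕ j) c (i≢j ∘ toℕ-injective) (toℕ<n i) (toℕ<n j) (m∸n≤m (2 ^ N) (toℕ g)) ⟩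
  2 ^ (N ∸ 2)
    ∎
  where
  open ≡-Reasoning
  c : ℕ
  c = 2 ^ N ∸ toℕ g

unionMult-zeroBitSet : ∀ N (i : Fin N) g → unionMult {{2^-nonZero N}} (zeroBitSet N) i g ≡ (N ∸ 1) * 2 ^ (N ∸ 2)
unionMult-zeroBitSet N i g = sum-filter-≢ i _ _ (λ j j≢i → Δmult-zeroBitSet N i j g (j≢i ∘ sym))

mainTheorem2 : (N : ℕ) → 1 < N →
    ∃ λ (A : Fin N → Subset (2 ^ N)) →
      IsNonDisjointSEDF (2 ^ N) N (2 ^ (N ∸ 1)) ((N ∸ 1) * 2 ^ (N ∸ 2)) {{m^n≢0 2 N}} A
mainTheorem2 N 1<N = zeroBitSet N , record
  { m>1   = 1<N
  ; size  = ∣zeroBitSet∣ N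
  ; count = unionMult-zeroBitSet N
  }
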